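{- Assume the hypotheses listed in the context, and let $\varsigma\colon Q\to B(Q,Q)$ be a morphism with $\varsigma\circ c=(\iota_\sim)^\clubsuit$. Then $(Q,\iota_\sim,\varsigma)$ is a $\rho$-bialgebra.
   Context: Hypotheses: $\mathbb{C}$ is a regular category with finite limits and finite colimits, $V$ an object, $\Sigma=V+\Sigma'\colon\mathbb{C}\to\mathbb{C}$ with $\Sigma'$ admitting free algebras (free monad $\Sigma^\star$), $\Sigma$ preserves reflexive coequalizers, $B\colon\mathbb{C}^{\mathsf{op}}\times\mathbb{C}\to\mathbb{C}$ preserves monomorphisms ($B(f,g)$ monic whenever $f$ epic and $g$ monic), $\rho$ is a $V$-pointed higher-order GSOS law of $\Sigma$ over $B$, i.e. a family $\rho_{X,Y}\colon\Sigma(jX\times B(jX,Y))\to B(jX,\Sigma^\star(jX+Y))$ dinatural in $X\in V/\mathbb{C}$ and natural in $Y\in\mathbb{C}$ ($j\colon V/\mathbb{C}\to\mathbb{C}$ forgetful from the coslice category; each $\Sigma$-algebra $(A,a)$ is $V$-pointed via $a\circ\mathrm{inl}$), and $B(\mu\Sigma,-)$ has a final coalgebra $(Z,\zeta)$. Notation: $(\mu\Sigma,\iota)$ initial algebra; $(\!|a|\!)$ unique algebra morphism into $(A,a)$; $\hat a\colon\Sigma^\star A\to A$ unique algebra morphism extending $\mathrm{id}_A$; $\nabla$ codiagonal; $a^\clubsuit\colon\mu\Sigma\to B(A,A)$ the unique morphism with $a^\clubsuit\circ\iota=B(\mathrm{id},\hat a)\circ B(\mathrm{id},\Sigma^\star\nabla)\circ\rho_{A,A}\circ\Sigma\langle(\!|a|\!),a^\clubsuit\rangle$,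 and $\iota^\clubsuit=(\iota)^\clubsuit$; $\mathrm{coit}\,\iota^\clubsuit\colon\mu\Sigma\to Z$ the unique coalgebra morphism. Let $p_1,p_2\colon E\to\mu\Sigma$ be the kernel pair of $\mathrm{coit}\,\iota^\clubsuit$, $p_i^\star=\hat\iota\circ\Sigma^\star p_i\colon\Sigma^\star E\to\mu\Sigma$, $c\colon\mu\Sigma\to Q$ a coequalizer of $p_1^\star,p_2^\star$, and $\iota_\sim\colon\Sigma Q\to Q$ the unique morphism with $\iota_\sim\circ\Sigma c=c\circ\iota$ (it exists since $\Sigma$ preserves this reflexive coequalizer). A $\rho$-bialgebra is a triple $(A,a,c')$ with $a\colon\Sigma A\to A$, $c'\colon A\to B(A,A)$ and $c'\circ a=B(\mathrm{id},\hat a)\circ B(\mathrm{id},\Sigma^\star\nabla)\circ\rho_{A,A}\circ\Sigma\langle\mathrm{id},c'\rangle$. -}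

module Defs where

open import Level using (Level; _⊔_) renaming (suc to lsuc)
open import Relation.Binary using (Rel; IsEquivalence)
open import Data.Product using (Σ; _×_; _,_; Σ-syntax; proj₁)

record Category (o ℓ e : Level) : Set (lsuc (o ⊔ ℓ ⊔ e)) where
  infixr 9 _∘_
  infix  4 _≈_
  infix  4 _⇒_
  field
    Obj       : Set o
    _⇒_       : Obj → Obj → Set ℓ
    _≈_       : ∀ {A B} → Rel (A ⇒ B) e
    id        : ∀ {A} → A ⇒ A
    _∘_       : ∀ {A B C} → B ⇒ C → A ⇒ B → A ⇒ C
    assoc     : ∀ {A B C D} {f : A ⇒ B} {g : B ⇒ C} {h : C ⇒ D} →
                (h ∘ g) ∘ f ≈ h ∘ (g ∘ f)
    identityˡ : ∀ {A B} {f : A ⇒ B} → id ∘ f ≈ f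
    identityʳ : ∀ {A B} {f : A ⇒ B} → f ∘ id ≈ f
    equiv     : ∀ {A B} → IsEquivalence (_≈_ {A} {B})
    ∘-resp-≈  : ∀ {A B C} {f h : B ⇒ C} {g i : A ⇒ B} →
                f ≈ h → g ≈ i → f ∘ g ≈ h ∘ i

module _ {o ℓ e : Level} (C : Category o ℓ e) where
  open Category C

  record Functor : Set (o ⊔ ℓ ⊔ e) where
    field
      F₀           : Obj → Obj
      F₁           : ∀ {A B} → A ⇒ B → F₀ A ⇒ F₀ B
      identity     : ∀ {A} → F₁ (id {A}) ≈ id
      homomorphism : ∀ {A B C} {f : A ⇒ B} {g : B ⇒ C} →
                     F₁ (g ∘ f) ≈ F₁ g ∘ F₁ f
      F-resp-≈     : ∀ {A B} {f g : A ⇒ B} → f ≈ g → F₁ f ≈ F₁ g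

  record MixedFunctor : Set (o ⊔ ℓ ⊔ e) where
    field
      B₀           : Obj → Obj → Obj
      B₁           : ∀ {A A' X X'} → A' ⇒ A → X ⇒ X' → B₀ A X ⇒ B₀ A' X'
      identity     : ∀ {A X} → B₁ (id {A}) (id {X}) ≈ id
      homomorphism : ∀ {A A' A'' X X' X''}
                     {f : A' ⇒ A} {f' : A'' ⇒ A'} {g : X ⇒ X'} {g' : X' ⇒ X''} →
                     B₁ (f ∘ f') (g' ∘ g) ≈ B₁ f' g' ∘ B₁ f g
      B-resp-≈     : ∀ {A A' X X'} {f f' : A' ⇒ A} {g g' : X ⇒ X'} →
                     f ≈ f' → g ≈ g' → B₁ f g ≈ B₁ f' g'

  Mono : ∀ {A B} → A ⇒ B → Set (o ⊔ ℓ ⊔ e)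
  Mono {A} f = ∀ {X} (g h : X ⇒ A) → f ∘ g ≈ f ∘ h → g ≈ h

  Epi : ∀ {A B} → A ⇒ B → Set (o ⊔ ℓ ⊔ e)
  Epi {B = B} f = ∀ {X} (g h : B ⇒ X) → g ∘ f ≈ h ∘ f → g ≈ h

  record IsCoequalizer {A B Q : Obj} (f g : A ⇒ B) (q : B ⇒ Q) : Set (o ⊔ ℓ ⊔ e) where
    field
      equality  : q ∘ f ≈ q ∘ g
      coequalize : ∀ {X} (h : B ⇒ X) → h ∘ f ≈ h ∘ g → Q ⇒ X
      universal  : ∀ {X} {h : B ⇒ X} (eq : h ∘ f ≈ h ∘ g) → coequalize h eq ∘ q ≈ h
      unique     : ∀ {X} {h : B ⇒ X} (eq : h ∘ f ≈ h ∘ g) (u : Q ⇒ X) →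
                   u ∘ q ≈ h → u ≈ coequalize h eq

  record IsEqualizer {E A B : Obj} (m : E ⇒ A) (f g : A ⇒ B) : Set (o ⊔ ℓ ⊔ e) where
    field
      equality  : f ∘ m ≈ g ∘ m
      equalize  : ∀ {X} (h : X ⇒ A) → f ∘ h ≈ g ∘ h → X ⇒ E
      universal : ∀ {X} {h : X ⇒ A} (eq : f ∘ h ≈ g ∘ h) → m ∘ equalize h eq ≈ h
      unique    : ∀ {X} {h : X ⇒ A} (eq : f ∘ h ≈ g ∘ h) (u : X ⇒ E) →
                  m ∘ u ≈ h → u ≈ equalize h eq

  RegularEpi : ∀ {B Q} → B ⇒ Q → Set (o ⊔ ℓ ⊔ e)
  RegularEpi {B} q = Σ[ A ∈ Obj ] Σ[ f ∈ A ⇒ B ] Σ[ g ∈ A ⇒ B ] IsCoequalizer f g q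

  record IsPullback {A B C P : Obj} (f : A ⇒ C) (g : B ⇒ C)
                    (p₁ : P ⇒ A) (p₂ : P ⇒ B) : Set (o ⊔ ℓ ⊔ e) where
    field
      commute   : f ∘ p₁ ≈ g ∘ p₂
      factor    : ∀ {X} (h₁ : X ⇒ A) (h₂ : X ⇒ B) → f ∘ h₁ ≈ g ∘ h₂ → X ⇒ P
      factor-p₁ : ∀ {X} {h₁ : X ⇒ A} {h₂ : X ⇒ B} (eq : f ∘ h₁ ≈ g ∘ h₂) →
                  p₁ ∘ factor h₁ h₂ eq ≈ h₁
      factor-p₂ : ∀ {X} {h₁ : X ⇒ A} {h₂ : X ⇒ B} (eq : f ∘ h₁ ≈ g ∘ h₂) →
                  p₂ ∘ factor h₁ h₂ eq ≈ h₂
      unique    : ∀ {X} {h₁ : X ⇒ A} {h₂ : X ⇒ B} (eq : f ∘ h₁ ≈ g ∘ h₂) (u : X ⇒ P) →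
                  p₁ ∘ u ≈ h₁ → p₂ ∘ u ≈ h₂ → u ≈ factor h₁ h₂ eq

  IsKernelPair : ∀ {A B E} → A ⇒ B → (p₁ p₂ : E ⇒ A) → Set (o ⊔ ℓ ⊔ e)
  IsKernelPair f p₁ p₂ = IsPullback f f p₁ p₂

  record Terminal : Set (o ⊔ ℓ ⊔ e) where
    field
      ⊤        : Obj
      !        : ∀ {A} → A ⇒ ⊤
      !-unique : ∀ {A} (f : A ⇒ ⊤) → ! ≈ f

  record Initial : Set (o ⊔ ℓ ⊔ e) where
    field
      ⊥        : Obj
      ¡        : ∀ {A} → ⊥ ⇒ A
      ¡-unique : ∀ {A} (f : ⊥ ⇒ A) → ¡ ≈ f

  record BinaryProducts : Set (o ⊔ ℓ ⊔ e) where
    infixr 7 _×ₒ_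
    field
      _×ₒ_    : Obj → Obj → Obj
      π₁      : ∀ {A B} → A ×ₒ B ⇒ A
      π₂      : ∀ {A B} → A ×ₒ B ⇒ B
      ⟨_,_⟩   : ∀ {X A B} → X ⇒ A → X ⇒ B → X ⇒ A ×ₒ B
      project₁ : ∀ {X A B} {f : X ⇒ A} {g : X ⇒ B} → π₁ ∘ ⟨ f , g ⟩ ≈ f
      project₂ : ∀ {X A B} {f : X ⇒ A} {g : X ⇒ B} → π₂ ∘ ⟨ f , g ⟩ ≈ g
      unique   : ∀ {X A B} {f : X ⇒ A} {g : X ⇒ B} {h : X ⇒ A ×ₒ B} →
                 π₁ ∘ h ≈ f → π₂ ∘ h ≈ g → ⟨ f , g ⟩ ≈ h

  record BinaryCoproducts : Set (o ⊔ ℓ ⊔ e) where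
    infixr 6 _+ₒ_
    field
      _+ₒ_    : Obj → Obj → Obj
      inl     : ∀ {A B} → A ⇒ A +ₒ B
      inr     : ∀ {A B} → B ⇒ A +ₒ B
      [_,_]   : ∀ {X A B} → A ⇒ X → B ⇒ X → A +ₒ B ⇒ X
      inject₁ : ∀ {X A B} {f : A ⇒ X} {g : B ⇒ X} → [ f , g ] ∘ inl ≈ f
      inject₂ : ∀ {X A B} {f : A ⇒ X} {g : B ⇒ X} → [ f , g ] ∘ inr ≈ g
      unique  : ∀ {X A B} {f : A ⇒ X} {g : B ⇒ X} {h : A +ₒ B ⇒ X} →
                h ∘ inl ≈ f → h ∘ inr ≈ g → [ f , g ] ≈ h

  record Equalizers : Set (o ⊔ ℓ ⊔ e) where
    field
      eqObj       : ∀ {A B} (f g : A ⇒ B) → Obj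
      eqArr       : ∀ {A B} (f g : A ⇒ B) → eqObj f g ⇒ A
      isEqualizer : ∀ {A B} (f g : A ⇒ B) → IsEqualizer (eqArr f g) f g

  record Coequalizers : Set (o ⊔ ℓ ⊔ e) where
    field
      coeqObj       : ∀ {A B} (f g : A ⇒ B) → Obj
      coeqArr       : ∀ {A B} (f g : A ⇒ B) → B ⇒ coeqObj f g
      isCoequalizer : ∀ {A B} (f g : A ⇒ B) → IsCoequalizer f g (coeqArr f g)

  record FiniteLimits : Set (o ⊔ ℓ ⊔ e) where
    field
      terminal   : Terminal
      products   : BinaryProducts
      equalizers : Equalizers

  record FiniteColimits : Set (o ⊔ ℓ ⊔ e) where
    field
      initial      : Initial
      coproducts   : BinaryCoproducts
      coequalizers : Coequalizers

  -- Regularity: (finite limits and coequalizers of kernel pairs are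
  -- supplied separately by FiniteLimits / FiniteColimits) regular
  -- epimorphisms are stable under pullback.
  RegularEpisPullbackStable : Set (o ⊔ ℓ ⊔ e)
  RegularEpisPullbackStable =
    ∀ {A B C P} (q : A ⇒ C) (g : B ⇒ C) (p₁ : P ⇒ A) (p₂ : P ⇒ B) →
    IsPullback q g p₁ p₂ → RegularEpi q → RegularEpi p₂

  record FreeAlgebras (F : Functor) : Set (o ⊔ ℓ ⊔ e) where
    open Functor F
    field
      Free     : Obj → Obj
      η        : ∀ {X} → X ⇒ Free X
      alg      : ∀ {X} → F₀ (Free X) ⇒ Free X
      ext      : ∀ {X A} → (a : F₀ A ⇒ A) → X ⇒ A → Free X ⇒ A
      ext-alg  : ∀ {X A} {a : F₀ A ⇒ A} {f : X ⇒ A} →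
                 ext a f ∘ alg ≈ a ∘ F₁ (ext a f)
      ext-η    : ∀ {X A} {a : F₀ A ⇒ A} {f : X ⇒ A} → ext a f ∘ η ≈ f
      ext-unique : ∀ {X A} {a : F₀ A ⇒ A} {f : X ⇒ A} (h : Free X ⇒ A) →
                   h ∘ alg ≈ a ∘ F₁ h → h ∘ η ≈ f → h ≈ ext a f

module Setting {o ℓ e : Level} (C : Category o ℓ e)
               (lim : FiniteLimits C) (colim : FiniteColimits C)
               (V : Category.Obj C) (Σ' : Functor C) (free : FreeAlgebras C Σ')
               (B : MixedFunctor C) where
  open Category C
  open FiniteLimits lim
  open FiniteColimits colim
  open BinaryProducts products
  open BinaryCoproducts coproducts
  open Functor Σ' renaming (F₀ to Σ'₀; F₁ to Σ'₁)
  open FreeAlgebras free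
  open MixedFunctor B

  infixr 7 _×₁_
  infixr 6 _+₁_

  _×₁_ : ∀ {A A' X X'} → A ⇒ A' → X ⇒ X' → A ×ₒ X ⇒ A' ×ₒ X'
  f ×₁ g = ⟨ f ∘ π₁ , g ∘ π₂ ⟩

  _+₁_ : ∀ {A A' X X'} → A ⇒ A' → X ⇒ X' → A +ₒ X ⇒ A' +ₒ X'
  f +₁ g = [ inl ∘ f , inr ∘ g ]

  ∇ : ∀ {A} → A +ₒ A ⇒ A
  ∇ = [ id , id ]

  Σ₀ : Obj → Obj
  Σ₀ X = V +ₒ Σ'₀ X

  Σ₁ : ∀ {X Y} → X ⇒ Y → Σ₀ X ⇒ Σ₀ Y
  Σ₁ f = id +₁ Σ'₁ f

  -- free Σ-algebras (free monad Σ⋆), built from the free Σ'-algebras: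
  -- Σ⋆ X = Σ'⋆ (V + X)
  Σ⋆₀ : Obj → Obj
  Σ⋆₀ X = Free (V +ₒ X)

  ηΣ : ∀ {X} → X ⇒ Σ⋆₀ X
  ηΣ = η ∘ inr

  algΣ : ∀ {X} → Σ₀ (Σ⋆₀ X) ⇒ Σ⋆₀ X
  algΣ = [ η ∘ inl , alg ]

  -- unique Σ-algebra morphism Σ⋆X → A extending f : X → A
  extΣ : ∀ {X A} → Σ₀ A ⇒ A → X ⇒ A → Σ⋆₀ X ⇒ A
  extΣ a f = ext (a ∘ inr) [ a ∘ inl , f ]

  Σ⋆₁ : ∀ {X Y} → X ⇒ Y → Σ⋆₀ X ⇒ Σ⋆₀ Y
  Σ⋆₁ f = extΣ algΣ (ηΣ ∘ f)

  hat : ∀ {A} → Σ₀ A ⇒ A → Σ⋆₀ A ⇒ A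
  hat a = extΣ a id

  PreservesReflexiveCoequalizers : Set (o ⊔ ℓ ⊔ e)
  PreservesReflexiveCoequalizers =
    ∀ {A X Q} (f g : A ⇒ X) (s : X ⇒ A) → f ∘ s ≈ id → g ∘ s ≈ id →
    (q : X ⇒ Q) → IsCoequalizer C f g q →
    IsCoequalizer C (Σ₁ f) (Σ₁ g) (Σ₁ q)

  PreservesMonos : Set (o ⊔ ℓ ⊔ e)
  PreservesMonos = ∀ {A A' X X'} (f : A' ⇒ A) (g : X ⇒ X') →
                   Epi C f → Mono C g → Mono C (B₁ f g)

  -- the coslice category V/C
  record Pointed : Set (o ⊔ ℓ) where
    constructor _,pt_
    field
      j  : Obj
      pt : V ⇒ j
  open Pointed public

  PointedHom : Pointed → Pointed → Set (ℓ ⊔ e)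
  PointedHom X X' = Σ[ f ∈ j X ⇒ j X' ] (f ∘ pt X ≈ pt X')

  GSOSFamily : Set (o ⊔ ℓ)
  GSOSFamily = (X : Pointed) (Y : Obj) →
               Σ₀ (j X ×ₒ B₀ (j X) Y) ⇒ B₀ (j X) (Σ⋆₀ (j X +ₒ Y))

  record IsHOGSOSLaw (ρ : GSOSFamily) : Set (o ⊔ ℓ ⊔ e) where
    field
      dinatural : ∀ {X X' : Pointed} {Y : Obj} (f : PointedHom X X') →
        B₁ id (Σ⋆₁ (proj₁ f +₁ id)) ∘ ρ X Y ∘ Σ₁ (id ×₁ B₁ (proj₁ f) id)
          ≈ B₁ (proj₁ f) id ∘ ρ X' Y ∘ Σ₁ (proj₁ f ×₁ id)
      natural : ∀ {X : Pointed} {Y Y' : Obj} (g : Y ⇒ Y') →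
        B₁ id (Σ⋆₁ (id +₁ g)) ∘ ρ X Y ≈ ρ X Y' ∘ Σ₁ (id ×₁ B₁ id g)

  pointed : ∀ {A} → Σ₀ A ⇒ A → Pointed
  pointed {A} a = A ,pt (a ∘ inl)

  record IsInitialAlgebra (μ : Obj) (ι : Σ₀ μ ⇒ μ) : Set (o ⊔ ℓ ⊔ e) where
    field
      fold        : ∀ {A} → Σ₀ A ⇒ A → μ ⇒ A
      fold-hom    : ∀ {A} {a : Σ₀ A ⇒ A} → fold a ∘ ι ≈ a ∘ Σ₁ (fold a)
      fold-unique : ∀ {A} {a : Σ₀ A ⇒ A} (h : μ ⇒ A) →
                    h ∘ ι ≈ a ∘ Σ₁ h → h ≈ fold a

  record IsFinalCoalgebra (μ Z : Obj) (ζ : Z ⇒ B₀ μ Z) : Set (o ⊔ ℓ ⊔ e) where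
    field
      coit        : ∀ {A} → A ⇒ B₀ μ A → A ⇒ Z
      coit-hom    : ∀ {A} {k : A ⇒ B₀ μ A} → ζ ∘ coit k ≈ B₁ id (coit k) ∘ k
      coit-unique : ∀ {A} {k : A ⇒ B₀ μ A} (h : A ⇒ Z) →
                    ζ ∘ h ≈ B₁ id h ∘ k → h ≈ coit k

  -- the defining equation of a♣ : μΣ → B(A,A)
  IsClub : (ρ : GSOSFamily) {μ : Obj} {ι : Σ₀ μ ⇒ μ} → IsInitialAlgebra μ ι →
           ∀ {A} (a : Σ₀ A ⇒ A) → μ ⇒ B₀ A A → Set e
  IsClub ρ {ι = ι} init {A} a k =
    k ∘ ι ≈ B₁ id (hat a) ∘ B₁ id (Σ⋆₁ ∇) ∘ ρ (pointed a) A
              ∘ Σ₁ ⟨ IsInitialAlgebra.fold init a , k ⟩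

  IsBialgebra : (ρ : GSOSFamily) {A : Obj} → Σ₀ A ⇒ A → A ⇒ B₀ A A → Set e
  IsBialgebra ρ {A} a c' =
    c' ∘ a ≈ B₁ id (hat a) ∘ B₁ id (Σ⋆₁ ∇) ∘ ρ (pointed a) A ∘ Σ₁ ⟨ id , c' ⟩

-- Σ c is an epimorphism: c coequalizes a reflexive pair (the diagonal of
-- the kernel pair supplies the common section), so Σ preserves this
-- coequalizer. It therefore suffices to check the bialgebra law after
-- precomposing with Σ c, and there it is the defining equation of (ι∼)♣,
-- because c is the fold of ι∼ and ς ∘ c = (ι∼)♣.
module Submission where

open import Defs
open import Level using (Level)
open import Relation.Binary using (Setoid; IsEquivalence)
import Relation.Binary.Reasoning.Setoid as SetoidReasoning

module CategoryLemmas {o ℓ e : Level} (C : Category o ℓ e) where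
  open Category C

  hom-setoid : Obj → Obj → Setoid ℓ e
  hom-setoid A B = record { Carrier = A ⇒ B ; _≈_ = _≈_ ; isEquivalence = equiv }

  module HomReasoning {A B : Obj} = SetoidReasoning (hom-setoid A B)

  ≈-refl : ∀ {A B} {f : A ⇒ B} → f ≈ f
  ≈-refl = IsEquivalence.refl equiv

  ≈-sym : ∀ {A B} {f g : A ⇒ B} → f ≈ g → g ≈ f
  ≈-sym = IsEquivalence.sym equiv

  ≈-trans : ∀ {A B} {f g h : A ⇒ B} → f ≈ g → g ≈ h → f ≈ h
  ≈-trans = IsEquivalence.trans equiv

  ∘-resp-≈ˡ : ∀ {A B D} {f : B ⇒ D} {g h : A ⇒ B} → g ≈ h → f ∘ g ≈ f ∘ h
  ∘-resp-≈ˡ = ∘-resp-≈ ≈-refl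

  ∘-resp-≈ʳ : ∀ {A B D} {f g : B ⇒ D} {h : A ⇒ B} → f ≈ g → f ∘ h ≈ g ∘ h
  ∘-resp-≈ʳ p = ∘-resp-≈ p ≈-refl

  coequalizer⇒epi : ∀ {A X Q} {f g : A ⇒ X} {q : X ⇒ Q} →
                    IsCoequalizer C f g q → Epi C q
  coequalizer⇒epi {f = f} {g} {q} coeq h k hq≈kq =
    ≈-trans (unique hq-coequalizes h ≈-refl)
            (≈-sym (unique hq-coequalizes k (≈-sym hq≈kq)))
    where
    open IsCoequalizer coeq
    hq-coequalizes : (h ∘ q) ∘ f ≈ (h ∘ q) ∘ g
    hq-coequalizes = ≈-trans assoc (≈-trans (∘-resp-≈ˡ equality) (≈-sym assoc))

  module _ {A B E} {f : A ⇒ B} {p₁ p₂ : E ⇒ A} (kp : IsKernelPair C f p₁ p₂) where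
    open IsPullback kp

    kernelPair-diagonal : A ⇒ E
    kernelPair-diagonal = factor id id ≈-refl

    p₁∘kernelPair-diagonal : p₁ ∘ kernelPair-diagonal ≈ id
    p₁∘kernelPair-diagonal = factor-p₁ ≈-refl

    p₂∘kernelPair-diagonal : p₂ ∘ kernelPair-diagonal ≈ id
    p₂∘kernelPair-diagonal = factor-p₂ ≈-refl

module SettingLemmas {o ℓ e : Level} (C : Category o ℓ e)
                     (lim : FiniteLimits C) (colim : FiniteColimits C)
                     (V : Category.Obj C) (Σ' : Functor C) (free : FreeAlgebras C Σ')
                     (B : MixedFunctor C) where
  open Category C
  open CategoryLemmas C
  open Setting C lim colim V Σ' free B
  open BinaryProducts (FiniteLimits.products lim) using (_×ₒ_; ⟨_,_⟩; project₁; project₂)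
    renaming (unique to ⟨⟩-unique)
  open BinaryCoproducts (FiniteColimits.coproducts colim) using (_+ₒ_; inl; inr; [_,_]; inject₁; inject₂)
    renaming (unique to []-unique)
  open Functor Σ' using () renaming (F₁ to Σ'₁; homomorphism to Σ'-homomorphism; F-resp-≈ to Σ'-resp-≈)
  open FreeAlgebras free using (η; ext-η)
  open MixedFunctor B using (B₀; B₁)

  ⟨⟩∘ : ∀ {X A D Y} {f : A ⇒ X} {g : A ⇒ D} {h : Y ⇒ A} →
        ⟨ f , g ⟩ ∘ h ≈ ⟨ f ∘ h , g ∘ h ⟩
  ⟨⟩∘ = ≈-sym (⟨⟩-unique (≈-trans (≈-sym assoc) (∘-resp-≈ʳ project₁))
                         (≈-trans (≈-sym assoc) (∘-resp-≈ʳ project₂)))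

  ⟨⟩-resp-≈ : ∀ {X A D} {f f' : X ⇒ A} {g g' : X ⇒ D} →
              f ≈ f' → g ≈ g' → ⟨ f , g ⟩ ≈ ⟨ f' , g' ⟩
  ⟨⟩-resp-≈ f≈f' g≈g' = ⟨⟩-unique (≈-trans project₁ (≈-sym f≈f'))
                                   (≈-trans project₂ (≈-sym g≈g'))

  Σ-homomorphism : ∀ {X Y W} {f : X ⇒ Y} {g : Y ⇒ W} → Σ₁ (g ∘ f) ≈ Σ₁ g ∘ Σ₁ f
  Σ-homomorphism {f = f} {g} = []-unique on-inl on-inr
    where
    open HomReasoning
    on-inl : (Σ₁ g ∘ Σ₁ f) ∘ inl ≈ inl ∘ id
    on-inl = begin
      (Σ₁ g ∘ Σ₁ f) ∘ inl ≈⟨ assoc ⟩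
      Σ₁ g ∘ (Σ₁ f ∘ inl) ≈⟨ ∘-resp-≈ˡ (≈-trans inject₁ identityʳ) ⟩
      Σ₁ g ∘ inl          ≈⟨ inject₁ ⟩
      inl ∘ id            ∎
    on-inr : (Σ₁ g ∘ Σ₁ f) ∘ inr ≈ inr ∘ Σ'₁ (g ∘ f)
    on-inr = begin
      (Σ₁ g ∘ Σ₁ f) ∘ inr   ≈⟨ assoc ⟩
      Σ₁ g ∘ (Σ₁ f ∘ inr)   ≈⟨ ∘-resp-≈ˡ inject₂ ⟩
      Σ₁ g ∘ (inr ∘ Σ'₁ f)  ≈⟨ ≈-sym assoc ⟩
      (Σ₁ g ∘ inr) ∘ Σ'₁ f  ≈⟨ ∘-resp-≈ʳ inject₂ ⟩
      (inr ∘ Σ'₁ g) ∘ Σ'₁ f ≈⟨ assoc ⟩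
      inr ∘ (Σ'₁ g ∘ Σ'₁ f) ≈⟨ ∘-resp-≈ˡ (≈-sym Σ'-homomorphism) ⟩
      inr ∘ Σ'₁ (g ∘ f)     ∎

  Σ-resp-≈ : ∀ {X Y} {f g : X ⇒ Y} → f ≈ g → Σ₁ f ≈ Σ₁ g
  Σ-resp-≈ f≈g = []-unique inject₁ (≈-trans inject₂ (∘-resp-≈ˡ (Σ'-resp-≈ (≈-sym f≈g))))

  extΣ-η : ∀ {X A} {a : Σ₀ A ⇒ A} {g : X ⇒ A} → extΣ a g ∘ ηΣ ≈ g
  extΣ-η {a = a} {g} = begin
    extΣ a g ∘ (η ∘ inr)  ≈⟨ ≈-sym assoc ⟩
    (extΣ a g ∘ η) ∘ inr  ≈⟨ ∘-resp-≈ʳ ext-η ⟩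
    [ a ∘ inl , g ] ∘ inr ≈⟨ inject₂ ⟩
    g                     ∎
    where open HomReasoning

  hat∘Σ⋆₁∘ηΣ : ∀ {X A} {a : Σ₀ A ⇒ A} {p : X ⇒ A} → (hat a ∘ Σ⋆₁ p) ∘ ηΣ ≈ p
  hat∘Σ⋆₁∘ηΣ {a = a} {p} = begin
    (hat a ∘ Σ⋆₁ p) ∘ ηΣ ≈⟨ assoc ⟩
    hat a ∘ (Σ⋆₁ p ∘ ηΣ) ≈⟨ ∘-resp-≈ˡ extΣ-η ⟩
    hat a ∘ (ηΣ ∘ p)     ≈⟨ ≈-sym assoc ⟩
    (hat a ∘ ηΣ) ∘ p     ≈⟨ ∘-resp-≈ʳ extΣ-η ⟩
    id ∘ p               ≈⟨ identityˡ ⟩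
    p                    ∎
    where open HomReasoning

  hat∘Σ⋆₁-section : ∀ {X A} {a : Σ₀ A ⇒ A} {p : X ⇒ A} {s : A ⇒ X} →
                    p ∘ s ≈ id → (hat a ∘ Σ⋆₁ p) ∘ (ηΣ ∘ s) ≈ id
  hat∘Σ⋆₁-section p∘s≈id =
    ≈-trans (≈-sym assoc) (≈-trans (∘-resp-≈ʳ hat∘Σ⋆₁∘ηΣ) p∘s≈id)

  Σ₁-kernelCoequalizer-epi :
    PreservesReflexiveCoequalizers →
    ∀ {A B E Q} {f : A ⇒ B} {p₁ p₂ : E ⇒ A} {a : Σ₀ A ⇒ A} {q : A ⇒ Q} →
    IsKernelPair C f p₁ p₂ →
    IsCoequalizer C (hat a ∘ Σ⋆₁ p₁) (hat a ∘ Σ⋆₁ p₂) q →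
    Epi C (Σ₁ q)
  Σ₁-kernelCoequalizer-epi preserves kp coeq =
    coequalizer⇒epi (preserves _ _ (ηΣ ∘ kernelPair-diagonal kp)
                               (hat∘Σ⋆₁-section (p₁∘kernelPair-diagonal kp))
                               (hat∘Σ⋆₁-section (p₂∘kernelPair-diagonal kp))
                               _ coeq)

  module _ (ρ : GSOSFamily) {μ : Obj} {ι : Σ₀ μ ⇒ μ} (init : IsInitialAlgebra μ ι) where
    open IsInitialAlgebra init using (fold; fold-unique)

    club-factor⇒bialgebra :
      ∀ {A} {a : Σ₀ A ⇒ A} (h : μ ⇒ A) → a ∘ Σ₁ h ≈ h ∘ ι → Epi C (Σ₁ h) →
      {k : μ ⇒ B₀ A A} → IsClub ρ init a k →
      (ς : A ⇒ B₀ A A) → ς ∘ h ≈ k →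
      IsBialgebra ρ a ς
    club-factor⇒bialgebra {A} {a} h h-hom Σh-epi {k} club ς ς∘h≈k =
      Σh-epi _ _ (begin
        (ς ∘ a) ∘ Σ₁ h                          ≈⟨ assoc ⟩
        ς ∘ (a ∘ Σ₁ h)                          ≈⟨ ∘-resp-≈ˡ h-hom ⟩
        ς ∘ (h ∘ ι)                             ≈⟨ ≈-sym assoc ⟩
        (ς ∘ h) ∘ ι                             ≈⟨ ∘-resp-≈ʳ ς∘h≈k ⟩
        k ∘ ι                                   ≈⟨ club ⟩
        B-hat ∘ B-∇ ∘ ρa ∘ Σ₁ ⟨ fold a , k ⟩    ≈⟨ inner (Σ-resp-≈ (≈-sym ⟨id,ς⟩∘h)) ⟩
        B-hat ∘ B-∇ ∘ ρa ∘ Σ₁ (⟨ id , ς ⟩ ∘ h)  ≈⟨ inner Σ-homomorphism ⟩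
        B-hat ∘ B-∇ ∘ ρa ∘ Σ₁ ⟨ id , ς ⟩ ∘ Σ₁ h ≈⟨ reassociate ⟩
        (B-hat ∘ B-∇ ∘ ρa ∘ Σ₁ ⟨ id , ς ⟩) ∘ Σ₁ h ∎)
      where
      open HomReasoning
      B-hat : B₀ A (Σ⋆₀ A) ⇒ B₀ A A
      B-hat = B₁ id (hat a)
      B-∇ : B₀ A (Σ⋆₀ (A +ₒ A)) ⇒ B₀ A (Σ⋆₀ A)
      B-∇ = B₁ id (Σ⋆₁ ∇)
      ρa : Σ₀ (A ×ₒ B₀ A A) ⇒ B₀ A (Σ⋆₀ (A +ₒ A))
      ρa = ρ (pointed a) A
      inner : ∀ {f g : Σ₀ μ ⇒ Σ₀ (A ×ₒ B₀ A A)} → f ≈ g →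
              B-hat ∘ B-∇ ∘ ρa ∘ f ≈ B-hat ∘ B-∇ ∘ ρa ∘ g
      inner f≈g = ∘-resp-≈ˡ (∘-resp-≈ˡ (∘-resp-≈ˡ f≈g))
      reassociate : B-hat ∘ B-∇ ∘ ρa ∘ Σ₁ ⟨ id , ς ⟩ ∘ Σ₁ h ≈
                    (B-hat ∘ B-∇ ∘ ρa ∘ Σ₁ ⟨ id , ς ⟩) ∘ Σ₁ h
      reassociate = ≈-sym (≈-trans assoc (∘-resp-≈ˡ (≈-trans assoc (∘-resp-≈ˡ assoc))))
      ⟨id,ς⟩∘h : ⟨ id , ς ⟩ ∘ h ≈ ⟨ fold a , k ⟩
      ⟨id,ς⟩∘h = ≈-trans ⟨⟩∘ (⟨⟩-resp-≈ (≈-trans identityˡ (fold-unique h (≈-sym h-hom))) ς∘h≈k)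

proposition4p22 : ∀ {o ℓ e : Level} (C : Category o ℓ e) →
    let open Category C in
    (lim : FiniteLimits C) (colim : FiniteColimits C) →
    RegularEpisPullbackStable C →
    (V : Obj) (Σ' : Functor C) (free : FreeAlgebras C Σ') (B : MixedFunctor C) →
    let open Setting C lim colim V Σ' free B
        open MixedFunctor B
    in
    PreservesReflexiveCoequalizers →
    PreservesMonos →
    (ρ : GSOSFamily) → IsHOGSOSLaw ρ →
    (μ : Obj) (ι : Σ₀ μ ⇒ μ) (init : IsInitialAlgebra μ ι) →
    (Z : Obj) (ζ : Z ⇒ B₀ μ Z) (final : IsFinalCoalgebra μ Z ζ) →
    (ιclub : μ ⇒ B₀ μ μ) → IsClub ρ init ι ιclub →
    (E : Obj) (p₁ p₂ : E ⇒ μ) →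
    IsKernelPair C (IsFinalCoalgebra.coit final ιclub) p₁ p₂ →
    (Q : Obj) (c : μ ⇒ Q) →
    IsCoequalizer C (hat ι ∘ Σ⋆₁ p₁) (hat ι ∘ Σ⋆₁ p₂) c →
    (ι∼ : Σ₀ Q ⇒ Q) → ι∼ ∘ Σ₁ c ≈ c ∘ ι →
    (ι∼club : μ ⇒ B₀ Q Q) → IsClub ρ init ι∼ ι∼club →
    (ς : Q ⇒ B₀ Q Q) → ς ∘ c ≈ ι∼club →
    IsBialgebra ρ ι∼ ς
proposition4p22 C lim colim _ V Σ' free B preserves _ ρ _ _ _ init _ _ _
                _ _ _ _ _ kp _ c coeq _ ι∼-hom _ club ς ς∘c =
  club-factor⇒bialgebra ρ init c ι∼-hom
                        (Σ₁-kernelCoequalizer-epi preserves kp coeq) club ς ς∘c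
  where open SettingLemmas C lim colim V Σ' free B
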